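{- Let $q\in\mathbb{N}$ with $q\ge3$, let $b\in\mathbb{N}$ and let $p_1,\ldots,p_\ell$ be distinct primes with $\gcd(q,bp_1p_2\cdots p_\ell)=1$. Then there exist $k_0\in\mathbb{N}$ and $a_1,\ldots,a_m\in\mathbb{Z}^*_{b(p_1\cdots p_\ell)^{k_0}}$ such that for all $k_1,\ldots,k_\ell\in\mathbb{N}_{\ge k_0}$, writing $N=bp_1^{k_1}\cdots p_\ell^{k_\ell}$, the quotient group satisfies $$\mathbb{Z}_N^*/\langle q\rangle_N=\{[a_1],[a_2],\ldots,[a_m]\},$$ where $[a_j]=\{q^na_j \bmod N: n\in\mathbb{N}\}$.
   Context: For $M\in\mathbb{N}_{\ge2}$, $\mathbb{Z}_M^*:=\{1\le n\le M:\gcd(n,M)=1\}$, a group under multiplication modulo $M$. For $a\in\mathbb{Z}_M^*$, $\langle a\rangle_M:=\{a^n\bmod M: n\in\mathbb{N}\}$ is the subgroup generated by $a$. $\mathbb{N}_{\ge n}=\{k\in\mathbb{N}:k\ge n\}$. -}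

module Defs where

open import Data.Nat using (ℕ; zero; suc; _+_; _*_; _^_; _≤_)
open import Data.Nat.GCD using (gcd)
open import Data.Fin using (Fin; zero; suc)
open import Data.Product using (_×_; ∃)
open import Relation.Binary.PropositionalEquality using (_≡_)

prodFin : (ℓ : ℕ) → (Fin ℓ → ℕ) → ℕ
prodFin zero    f = 1
prodFin (suc ℓ) f = f zero * prodFin ℓ (λ i → f (suc i))

InUnits : ℕ → ℕ → Set
InUnits M x = (1 ≤ x) × (x ≤ M) × (gcd x M ≡ 1)

CongMod : (N x y : ℕ) → Set
CongMod N x y = ∃ λ u → ∃ λ v → x + u * N ≡ y + v * N

InCoset : (q N a : ℕ) → ℕ → Set
InCoset q N a x = InUnits N x × ∃ λ n → CongMod N x (q ^ n * a)

SameSet : (ℕ → Set) → (ℕ → Set) → Set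
SameSet P Q = ∀ x → (P x → Q x) × (Q x → P x)

{-# OPTIONS --safe #-}
module Submission where

-- Put P = p₁ ⋯ p_ℓ. Some power u = q ^ d is ≡ 1 modulo b * P², and writing u = 1 + A * g with
-- g prime to P fixes a modulus A = b * ∏ p_i ^ α_i with all α_i ≥ 2. For N = b * ∏ p_i ^ k_i
-- with k_i ≥ α_i, every unit x ≡ a (mod A) is ≡ u ^ e * a (mod N) for some e. This is proved
-- by going from N to N * p_i: if u ^ E = 1 + N * g with g prime to P, then u ^ (E * p_i) has
-- the same shape one level up, and since (1 + N * g) ^ j ≡ 1 + j * N * g (mod N * p_i),
-- replacing e by e + E * j for a suitable j absorbs the next p_i-adic digit of x − u ^ e * a.
-- So the kernel of ℤ_N^* → ℤ_M^*, M = b * P ^ k₀, lies in ⟨q⟩_N, and the units modulo M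
-- represent every coset of ⟨q⟩_N.

open import Defs
open import Data.Nat
open import Data.Nat.Properties
open import Data.Nat.Divisibility
open import Data.Nat.DivMod using (_%_; _/_; m≡m%n+[m/n]*n; m%n<n)
open import Data.Nat.GCD using (gcd; gcd-identityʳ; module Bézout)
open import Data.Nat.Coprimality as Coprimality
  using (Coprime; coprime?; coprime-divisor; coprime-Bézout; gcd≡1⇒coprime; coprime⇒gcd≡1)
open import Data.Nat.Primality using (Prime; prime⇒nonZero; prime⇒irreducible)
open import Data.Nat.Induction using (<-rec)
open import Data.Nat.Tactic.RingSolver using (solve-∀)
open import Data.Fin using (Fin; zero; suc; toℕ; fromℕ<)
open import Data.Fin.Properties using (pigeonhole; toℕ-fromℕ<; toℕ<n)
open import Data.Product using (_×_; _,_; proj₁; proj₂; ∃; ∃₂; Σ; map)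
open import Data.Sum using (inj₁; inj₂)
open import Data.Empty using (⊥-elim)
open import Function.Definitions using (Injective)
open import Relation.Binary.Bundles using (Setoid)
open import Relation.Binary.Structures using (IsEquivalence)
open import Relation.Nullary using (¬_; yes; no; contradiction)
open import Relation.Binary.PropositionalEquality

CongMod-refl : ∀ {m x} → CongMod m x x
CongMod-refl = 0 , 0 , refl

CongMod-sym : ∀ {m x y} → CongMod m x y → CongMod m y x
CongMod-sym (u , v , eq) = v , u , sym eq

CongMod-trans : ∀ {m x y z} → CongMod m x y → CongMod m y z → CongMod m x z
CongMod-trans {m} {x} {y} {z} (u , v , x≡y) (u′ , v′ , y≡z) = u + u′ , v′ + v , (begin
  x + (u + u′) * m     ≡⟨ reassoc x u u′ m ⟩
  (x + u * m) + u′ * m ≡⟨ cong (_+ u′ * m) x≡y ⟩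
  (y + v * m) + u′ * m ≡⟨ swap y v u′ m ⟩
  (y + u′ * m) + v * m ≡⟨ cong (_+ v * m) y≡z ⟩
  (z + v′ * m) + v * m ≡⟨ reassoc z v′ v m ⟨
  z + (v′ + v) * m     ∎)
  where
  open ≡-Reasoning
  reassoc : ∀ x u u′ m → x + (u + u′) * m ≡ (x + u * m) + u′ * m
  reassoc = solve-∀
  swap : ∀ y v u′ m → (y + v * m) + u′ * m ≡ (y + u′ * m) + v * m
  swap = solve-∀

CongMod-isEquivalence : ∀ m → IsEquivalence (CongMod m)
CongMod-isEquivalence m = record { refl = CongMod-refl ; sym = CongMod-sym ; trans = CongMod-trans }

CongMod-setoid : ℕ → Setoid _ _
CongMod-setoid m = record { isEquivalence = CongMod-isEquivalence m }

module CongMod-Reasoning (m : ℕ) where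
  open import Relation.Binary.Reasoning.Setoid (CongMod-setoid m) public

x≡y+k*m⇒CongMod : ∀ {m x y} k → x ≡ y + k * m → CongMod m x y
x≡y+k*m⇒CongMod {x = x} k eq = 0 , k , trans (+-identityʳ x) eq

CongMod-% : ∀ m x .{{_ : NonZero m}} → CongMod m x (x % m)
CongMod-% m x = x≡y+k*m⇒CongMod (x / m) (m≡m%n+[m/n]*n x m)

CongMod-+ˡ : ∀ {m x y} c → CongMod m x y → CongMod m (c + x) (c + y)
CongMod-+ˡ {m} {x} {y} c (u , v , eq) = u , v , (begin
  c + x + u * m   ≡⟨ +-assoc c x (u * m) ⟩
  c + (x + u * m) ≡⟨ cong (c +_) eq ⟩
  c + (y + v * m) ≡⟨ +-assoc c y (v * m) ⟨
  c + y + v * m   ∎)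
  where open ≡-Reasoning

CongMod-+-cancelʳ : ∀ {m x y} c → CongMod m (x + c) (y + c) → CongMod m x y
CongMod-+-cancelʳ {m} {x} {y} c (u , v , eq) = u , v , +-cancelʳ-≡ c _ _ (begin
  x + u * m + c   ≡⟨ swap x c (u * m) ⟩
  x + c + u * m   ≡⟨ eq ⟩
  y + c + v * m   ≡⟨ swap y c (v * m) ⟨
  y + v * m + c   ∎)
  where
  open ≡-Reasoning
  swap : ∀ x c k → x + k + c ≡ x + c + k
  swap = solve-∀

CongMod-scale : ∀ {m x y} c → CongMod m x y → CongMod (c * m) (c * x) (c * y)
CongMod-scale {m} {x} {y} c (u , v , eq) = u , v , (begin
  c * x + u * (c * m) ≡⟨ distrib c x u m ⟩
  c * (x + u * m)     ≡⟨ cong (c *_) eq ⟩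
  c * (y + v * m)     ≡⟨ distrib c y v m ⟨
  c * y + v * (c * m) ∎)
  where
  open ≡-Reasoning
  distrib : ∀ c x u m → c * x + u * (c * m) ≡ c * (x + u * m)
  distrib = solve-∀

CongMod-∣ : ∀ {d m x y} → d ∣ m → CongMod m x y → CongMod d x y
CongMod-∣ {d} {m} {x} {y} (divides r refl) (u , v , eq) = u * r , v * r , (begin
  x + u * r * d   ≡⟨ cong (x +_) (*-assoc u r d) ⟩
  x + u * (r * d) ≡⟨ eq ⟩
  y + v * (r * d) ≡⟨ cong (y +_) (*-assoc v r d) ⟨
  y + v * r * d   ∎)
  where open ≡-Reasoning

CongMod-*ˡ : ∀ {m x y} c → CongMod m x y → CongMod m (c * x) (c * y)
CongMod-*ˡ c x≡y = CongMod-∣ (n∣m*n c) (CongMod-scale c x≡y)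

CongMod-+ʳ⇒∣ : ∀ {m x k} → CongMod m (x + k) x → m ∣ k
CongMod-+ʳ⇒∣ {m} {x} {k} (u , v , eq) = ∣m+n∣m⇒∣n (divides v (+-cancelˡ-≡ x _ _ (begin
  x + (u * m + k) ≡⟨ swap x k (u * m) ⟩
  x + k + u * m   ≡⟨ eq ⟩
  x + v * m       ∎))) (n∣m*n u)
  where
  open ≡-Reasoning
  swap : ∀ x k l → x + (l + k) ≡ x + k + l
  swap = solve-∀

CongMod-pres-∣ : ∀ {m d x y} → d ∣ m → CongMod m x y → d ∣ x → d ∣ y
CongMod-pres-∣ {m} {d} {x} {y} d∣m (u , v , eq) d∣x =
  ∣m+n∣m⇒∣n (subst (d ∣_) (trans eq (+-comm y (v * m))) (∣m∣n⇒∣m+n d∣x (∣-trans d∣m (n∣m*n u))))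
            (∣-trans d∣m (n∣m*n v))

CongMod-+N*N* : ∀ {N p} y X → p ∣ N → CongMod (N * p) (y + N * N * X) y
CongMod-+N*N* {p = p} y X (divides r refl) = x≡y+k*m⇒CongMod (r * X) (cong (y +_) (reorder r p X))
  where
  reorder : ∀ r p X → r * p * (r * p) * X ≡ r * X * (r * p * p)
  reorder = solve-∀

coprime-∣ʳ : ∀ {m n o} → Coprime m n → o ∣ n → Coprime m o
coprime-∣ʳ m⊥n o∣n (i∣m , i∣o) = m⊥n (i∣m , ∣-trans i∣o o∣n)

coprime-*ʳ : ∀ {m n o} → Coprime m n → Coprime m o → Coprime m (n * o)
coprime-*ʳ {m} {n} m⊥n m⊥o {i} (i∣m , i∣n*o) = m⊥o (i∣m , coprime-divisor i⊥n i∣n*o)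
  where
  i⊥n : Coprime i n
  i⊥n (j∣i , j∣n) = m⊥n (∣-trans j∣i i∣m , j∣n)

coprime-*ˡ : ∀ {m n o} → Coprime m o → Coprime n o → Coprime (m * n) o
coprime-*ˡ m⊥o n⊥o = Coprimality.sym (coprime-*ʳ (Coprimality.sym m⊥o) (Coprimality.sym n⊥o))

coprime-^ʳ : ∀ {m n} → Coprime m n → ∀ k → Coprime m (n ^ k)
coprime-^ʳ {m} m⊥n zero    = Coprimality.sym (Coprimality.1-coprimeTo m)
coprime-^ʳ     m⊥n (suc k) = coprime-*ʳ m⊥n (coprime-^ʳ m⊥n k)

coprime-^ˡ : ∀ {m n} → Coprime m n → ∀ k → Coprime (m ^ k) n
coprime-^ˡ m⊥n k = Coprimality.sym (coprime-^ʳ (Coprimality.sym m⊥n) k)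

coprime-prodFinʳ : ∀ {m} ℓ {f : Fin ℓ → ℕ} → (∀ i → Coprime m (f i)) → Coprime m (prodFin ℓ f)
coprime-prodFinʳ {m} zero    m⊥f = Coprimality.sym (Coprimality.1-coprimeTo m)
coprime-prodFinʳ     (suc ℓ) m⊥f = coprime-*ʳ (m⊥f zero) (coprime-prodFinʳ ℓ (λ i → m⊥f (suc i)))

coprime-1+* : ∀ n k → Coprime (1 + n * k) n
coprime-1+* n k {i} (i∣1+n*k , i∣n) =
  ∣1⇒≡1 (∣m+n∣m⇒∣n (subst (i ∣_) (+-comm 1 (n * k)) i∣1+n*k) (∣-trans i∣n (m∣m*n k)))

prime∤⇒coprime : ∀ {p m} → Prime p → ¬ p ∣ m → Coprime m p
prime∤⇒coprime p-prime p∤m (i∣m , i∣p) with prime⇒irreducible p-prime i∣p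
... | inj₁ i≡1 = i≡1
... | inj₂ refl = contradiction i∣m p∤m

coprime-∣ˡ : ∀ {m n o} → Coprime m n → o ∣ m → Coprime o n
coprime-∣ˡ m⊥n o∣m = Coprimality.sym (coprime-∣ʳ (Coprimality.sym m⊥n) o∣m)

CongMod-coprime : ∀ {n x y} → CongMod n x y → Coprime x n → Coprime y n
CongMod-coprime x≡y x⊥n (i∣y , i∣n) = x⊥n (CongMod-pres-∣ i∣n (CongMod-sym x≡y) i∣y , i∣n)

linear-congruence-solvable : ∀ {p z} .{{_ : NonZero p}} → Coprime z p →
                             ∀ s t → ∃ λ j → CongMod p (j * z + s) t
-- Bézout gives x * z ≡ 1 or x * z ≡ −1 (mod p); then j = x * c with c ≡ t − s resp. s − t,
-- made non-negative by adding p * s resp. p * t.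
linear-congruence-solvable {suc p′} {z} z⊥p s t with coprime-Bézout z⊥p
... | Bézout.+- x y 1+yp≡xz = x * c , x≡y+k*m⇒CongMod (s + y * c) (begin
  x * c * z + s       ≡⟨ swap x c z s ⟩
  x * z * c + s       ≡⟨ cong (λ v → v * c + s) 1+yp≡xz ⟨
  (1 + y * p) * c + s ≡⟨ expand t s y p′ ⟩
  t + (s + y * c) * p ∎)
  where
  open ≡-Reasoning
  p c : ℕ
  p = suc p′
  c = t + p′ * s
  swap : ∀ x c z s → x * c * z + s ≡ x * z * c + s
  swap = solve-∀
  expand : ∀ t s y p′ → (1 + y * suc p′) * (t + p′ * s) + s ≡ t + (s + y * (t + p′ * s)) * suc p′
  expand = solve-∀
... | Bézout.-+ x y 1+xz≡yp = x * c , t , y * c , (begin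
  x * c * z + s + t * p ≡⟨ expand x z s t p′ ⟩
  (1 + x * z) * c + t   ≡⟨ cong (λ v → v * c + t) 1+xz≡yp ⟩
  y * p * c + t         ≡⟨ swap y p c t ⟩
  t + y * c * p         ∎)
  where
  open ≡-Reasoning
  p c : ℕ
  p = suc p′
  c = s + p′ * t
  expand : ∀ x z s t p′ → x * (s + p′ * t) * z + s + t * suc p′ ≡ (1 + x * z) * (s + p′ * t) + t
  expand = solve-∀
  swap : ∀ y p c t → y * p * c + t ≡ t + y * c * p
  swap = solve-∀

pow-residues-collide : ∀ q K .{{_ : NonZero K}} → ∃₂ λ a c → a < c × CongMod K (q ^ a) (q ^ c)
pow-residues-collide q K with pigeonhole (n<1+n K) residue
  where
  residue : Fin (suc K) → Fin K
  residue i = fromℕ< (m%n<n (q ^ toℕ i) K)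
... | i , j , i<j , same-residue = toℕ i , toℕ j , i<j , (begin
  q ^ toℕ i       ≈⟨ CongMod-% K (q ^ toℕ i) ⟩
  q ^ toℕ i % K   ≡⟨ toℕ-fromℕ< (m%n<n (q ^ toℕ i) K) ⟨
  toℕ (fromℕ< _)  ≡⟨ cong toℕ same-residue ⟩
  toℕ (fromℕ< _)  ≡⟨ toℕ-fromℕ< (m%n<n (q ^ toℕ j) K) ⟩
  q ^ toℕ j % K   ≈⟨ CongMod-% K (q ^ toℕ j) ⟨
  q ^ toℕ j       ∎)
  where open CongMod-Reasoning K

pow≡1+multiple : ∀ {q K} .{{_ : NonZero q}} .{{_ : NonZero K}} → Coprime q K →
                 ∃₂ λ D w → q ^ suc D ≡ 1 + K * w
pow≡1+multiple {q} {K} q⊥K = from-collision (pow-residues-collide q K)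
  where
  from-collision : (∃₂ λ a c → a < c × CongMod K (q ^ a) (q ^ c)) → ∃₂ λ D w → q ^ suc D ≡ 1 + K * w
  from-collision (a , c , a<c , qᵃ≡qᶜ) = D , w , (begin
    q ^ suc D      ≡⟨ m+[n∸m]≡n (m^n>0 q (suc D)) ⟨
    1 + m          ≡⟨ cong (1 +_) (trans m≡w*K (*-comm w K)) ⟩
    1 + K * w      ∎)
    where
    open ≡-Reasoning
    D m : ℕ
    D = c ∸ suc a
    m = q ^ suc D ∸ 1
    qᶜ≡qᵃ+qᵃ*m : q ^ c ≡ q ^ a + q ^ a * m
    qᶜ≡qᵃ+qᵃ*m = begin
      q ^ c                 ≡⟨ cong (q ^_) (m+[n∸m]≡n a<c) ⟨
      q ^ (suc a + D)       ≡⟨ cong (q ^_) (+-suc a D) ⟨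
      q ^ (a + suc D)       ≡⟨ ^-distribˡ-+-* q a (suc D) ⟩
      q ^ a * q ^ suc D     ≡⟨ cong (q ^ a *_) (m+[n∸m]≡n (m^n>0 q (suc D))) ⟨
      q ^ a * (1 + m)       ≡⟨ *-distribˡ-+ (q ^ a) 1 m ⟩
      q ^ a * 1 + q ^ a * m ≡⟨ cong (_+ q ^ a * m) (*-identityʳ (q ^ a)) ⟩
      q ^ a + q ^ a * m     ∎
    K∣m : K ∣ m
    K∣m = coprime-divisor (Coprimality.sym (coprime-^ˡ q⊥K a))
            (CongMod-+ʳ⇒∣ (subst (λ v → CongMod K v (q ^ a)) qᶜ≡qᵃ+qᵃ*m (CongMod-sym qᵃ≡qᶜ)))
    w : ℕ
    w = _∣_.quotient K∣m
    m≡w*K : m ≡ w * K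
    m≡w*K = _∣_.equality K∣m

[1+m]^n≡1+n*m+m*m*h : ∀ m n → ∃ λ h → (1 + m) ^ n ≡ 1 + n * m + m * m * h
[1+m]^n≡1+n*m+m*m*h m zero    = 0 , base m
  where
  base : ∀ m → 1 ≡ 1 + 0 * m + m * m * 0
  base = solve-∀
[1+m]^n≡1+n*m+m*m*h m (suc n) with [1+m]^n≡1+n*m+m*m*h m n
... | h , eq = n + h + m * h , trans (cong ((1 + m) *_) eq) (step m n h)
  where
  step : ∀ m n h → (1 + m) * (1 + n * m + m * m * h) ≡ 1 + suc n * m + m * m * (n + h + m * h)
  step = solve-∀

prodFin-* : ∀ ℓ (f g : Fin ℓ → ℕ) → prodFin ℓ (λ i → f i * g i) ≡ prodFin ℓ f * prodFin ℓ g
prodFin-* zero    f g = refl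
prodFin-* (suc ℓ) f g = trans (cong (f zero * g zero *_) (prodFin-* ℓ _ _)) (swap (f zero) (g zero) _ _)
  where
  swap : ∀ a b c d → a * b * (c * d) ≡ a * c * (b * d)
  swap = solve-∀

prodFin-cong : ∀ ℓ {f g : Fin ℓ → ℕ} → (∀ i → f i ≡ g i) → prodFin ℓ f ≡ prodFin ℓ g
prodFin-cong zero    f≡g = refl
prodFin-cong (suc ℓ) f≡g = cong₂ _*_ (f≡g zero) (prodFin-cong ℓ (λ i → f≡g (suc i)))

prodFin-^ : ∀ ℓ (f : Fin ℓ → ℕ) k → prodFin ℓ f ^ k ≡ prodFin ℓ (λ i → f i ^ k)
prodFin-^ ℓ       f (suc k) = trans (cong (prodFin ℓ f *_) (prodFin-^ ℓ f k)) (sym (prodFin-* ℓ f _))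
prodFin-^ zero    f zero    = refl
prodFin-^ (suc ℓ) f zero    = trans (prodFin-^ ℓ (λ i → f (suc i)) zero) (sym (*-identityˡ _))

∣prodFin : ∀ ℓ (f : Fin ℓ → ℕ) i → f i ∣ prodFin ℓ f
∣prodFin (suc ℓ) f zero    = m∣m*n _
∣prodFin (suc ℓ) f (suc i) = ∣-trans (∣prodFin ℓ (λ j → f (suc j)) i) (n∣m*n (f zero))

prodFin-nonZero : ∀ ℓ {f : Fin ℓ → ℕ} → (∀ i → NonZero (f i)) → NonZero (prodFin ℓ f)
prodFin-nonZero zero    f≢0 = _
prodFin-nonZero (suc ℓ) f≢0 = m*n≢0 _ _ {{f≢0 zero}} {{prodFin-nonZero ℓ (λ i → f≢0 (suc i))}}

1<1+K*w⇒w≢0 : ∀ {K w} → 1 < 1 + K * w → NonZero w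
1<1+K*w⇒w≢0 {K} {zero}  1<1+K*0 = contradiction (subst (1 <_) (cong suc (*-zeroʳ K)) 1<1+K*0) (<-irrefl refl)
1<1+K*w⇒w≢0 {K} {suc w} _       = _

maxFin : ∀ ℓ → (Fin ℓ → ℕ) → ℕ
maxFin zero    f = 0
maxFin (suc ℓ) f = f zero ⊔ maxFin ℓ (λ i → f (suc i))

≤maxFin : ∀ ℓ (f : Fin ℓ → ℕ) i → f i ≤ maxFin ℓ f
≤maxFin (suc ℓ) f zero    = m≤m⊔n (f zero) _
≤maxFin (suc ℓ) f (suc i) = ≤-trans (≤maxFin ℓ (λ j → f (suc j)) i) (m≤n⊔m (f zero) _)

split-prime-power : ∀ {p} → Prime p → ∀ n → .{{NonZero n}} → ∃₂ λ β g → n ≡ p ^ β * g × ¬ p ∣ g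
split-prime-power {p} p-prime = <-rec Split go
  where
  Split : ℕ → Set
  Split n = .{{NonZero n}} → ∃₂ λ β g → n ≡ p ^ β * g × ¬ p ∣ g
  go : ∀ n → (∀ {m} → m < n → Split m) → Split n
  go n rec with p ∣? n
  ... | no p∤n = 0 , n , sym (+-identityʳ n) , p∤n
  ... | yes (divides m refl) with rec (m<m*n m p {{m≢0}} (nonTrivial⇒n>1 p)) {{m≢0}}
    where
    m≢0 : NonZero m
    m≢0 = m*n≢0⇒m≢0 m
  ...   | β , g , m≡pᵝg , p∤g = suc β , g , (begin
    m * p           ≡⟨ cong (_* p) m≡pᵝg ⟩
    p ^ β * g * p   ≡⟨ swap (p ^ β) g p ⟩
    p * p ^ β * g   ∎) , p∤g
    where
    open ≡-Reasoning
    swap : ∀ a g p → a * g * p ≡ p * a * g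
    swap = solve-∀

split-prime-powers : ∀ ℓ (p : Fin ℓ → ℕ) → (∀ i → Prime (p i)) → ∀ n → .{{NonZero n}} →
  ∃₂ λ (β : Fin ℓ → ℕ) g → n ≡ prodFin ℓ (λ i → p i ^ β i) * g × Coprime g (prodFin ℓ p)
split-prime-powers zero    p p-prime n = (λ ()) , n , sym (*-identityˡ n) , Coprimality.sym (Coprimality.1-coprimeTo n)
split-prime-powers (suc ℓ) p p-prime n {{n≢0}}
  with split-prime-powers ℓ (λ i → p (suc i)) (λ i → p-prime (suc i)) n
... | βₜ , g′ , n≡Πₜg′ , g′⊥Pₜ
  with split-prime-power (p-prime zero) g′ {{m*n≢0⇒n≢0 (prodFin ℓ _) {{subst NonZero n≡Πₜg′ n≢0}}}}
...   | β₀ , g , g′≡p₀ᵝg , p₀∤g = β , g , n≡Πg , coprime-*ʳ (prime∤⇒coprime (p-prime zero) p₀∤g)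
                                                  (coprime-∣ˡ g′⊥Pₜ (divides (p zero ^ β₀) g′≡p₀ᵝg))
  where
  β : Fin (suc ℓ) → ℕ
  β zero    = β₀
  β (suc i) = βₜ i
  n≡Πg : n ≡ prodFin (suc ℓ) (λ i → p i ^ β i) * g
  n≡Πg = begin
    n                                 ≡⟨ n≡Πₜg′ ⟩
    Πₜ * g′                           ≡⟨ cong (Πₜ *_) g′≡p₀ᵝg ⟩
    Πₜ * (p zero ^ β₀ * g)            ≡⟨ swap Πₜ (p zero ^ β₀) g ⟩
    p zero ^ β₀ * Πₜ * g              ∎
    where
    open ≡-Reasoning
    Πₜ : ℕ
    Πₜ = prodFin ℓ (λ i → p (suc i) ^ βₜ i)
    swap : ∀ a b c → a * (b * c) ≡ b * a * c
    swap = solve-∀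

-- Lifting congruences along the primes of P

module Lifting (u P A : ℕ) (u⊥P : Coprime u P) where

  Level : ℕ → Set
  Level N = ∃₂ λ E g → u ^ E ≡ 1 + N * g × Coprime g P

  Lifts : ℕ → Set
  Lifts N = ∀ x a → CongMod A x a → Coprime a P → ∃ λ e → CongMod N x (u ^ e * a)

  Invariant : ℕ → Set
  Invariant N = P * P ∣ N × Level N × Lifts N

  level-step : ∀ {N p} → P * p ∣ N → Level N → Level (N * p)
  level-step {N} {p} (divides r N≡r*Pp) (E , g , uᴱ≡1+Ng , g⊥P) with [1+m]^n≡1+n*m+m*m*h (N * g) p
  ... | h , expansion = E * p , g * (1 + P * (r * g * h)) , (begin
    u ^ (E * p)                                     ≡⟨ ^-*-assoc u E p ⟨
    (u ^ E) ^ p                                     ≡⟨ cong (_^ p) uᴱ≡1+Ng ⟩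
    (1 + N * g) ^ p                                 ≡⟨ expansion ⟩
    1 + p * (N * g) + N * g * (N * g) * h           ≡⟨ cong (λ v → 1 + p * (N * g) + N * g * (v * g) * h) N≡r*Pp ⟩
    1 + p * (N * g) + N * g * (r * (P * p) * g) * h ≡⟨ regroup N r P p g h ⟩
    1 + N * p * (g * (1 + P * (r * g * h)))         ∎) , coprime-*ˡ g⊥P (coprime-1+* P _)
    where
    open ≡-Reasoning
    regroup : ∀ N r P p g h → 1 + p * (N * g) + N * g * (r * (P * p) * g) * h
                             ≡ 1 + N * p * (g * (1 + P * (r * g * h)))
    regroup = solve-∀

  lifts-step : ∀ {N p} .{{_ : NonZero p}} → p ∣ P → p ∣ N → Level N → Lifts N → Lifts (N * p)
  lifts-step {N} {p} p∣P p∣N (E , g , uᴱ≡1+Ng , g⊥P) lifts x a x≡a a⊥P with lifts x a x≡a a⊥P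
  ... | e , s , t , x+sN≡uᵉa+tN
    with linear-congruence-solvable (coprime-∣ʳ (coprime-*ˡ g⊥P (coprime-*ˡ (coprime-^ˡ u⊥P e) a⊥P)) p∣P) s t
  ... | j , jz+s≡t with [1+m]^n≡1+n*m+m*m*h (N * g) j
  -- j is chosen so that N * (j * z) makes up the difference (t − s) * N modulo N * p.
  ... | h , expansion = e + E * j , CongMod-trans x≡U+Njz (CongMod-sym uᵉ⁺ᴱʲa≡U+Njz)
    where
    U z : ℕ
    U = u ^ e * a
    z = g * U
    x≡U+Njz : CongMod (N * p) x (U + N * (j * z))
    x≡U+Njz = CongMod-+-cancelʳ (s * N) (begin
      x + s * N               ≡⟨ x+sN≡uᵉa+tN ⟩
      U + t * N               ≡⟨ cong (U +_) (*-comm t N) ⟩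
      U + N * t               ≈⟨ CongMod-+ˡ U (CongMod-scale N jz+s≡t) ⟨
      U + N * (j * z + s)     ≡⟨ regroup U N (j * z) s ⟩
      U + N * (j * z) + s * N ∎)
      where
      open CongMod-Reasoning (N * p)
      regroup : ∀ U N k s → U + N * (k + s) ≡ U + N * k + s * N
      regroup = solve-∀
    uᵉ⁺ᴱʲa≡U+Njz : CongMod (N * p) (u ^ (e + E * j) * a) (U + N * (j * z))
    uᵉ⁺ᴱʲa≡U+Njz = begin
      u ^ (e + E * j) * a                                ≡⟨ cong (_* a) (^-distribˡ-+-* u e (E * j)) ⟩
      u ^ e * u ^ (E * j) * a                            ≡⟨ cong (λ v → u ^ e * v * a) (^-*-assoc u E j) ⟨
      u ^ e * (u ^ E) ^ j * a                            ≡⟨ cong (λ v → u ^ e * v ^ j * a) uᴱ≡1+Ng ⟩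
      u ^ e * (1 + N * g) ^ j * a                        ≡⟨ cong (λ v → u ^ e * v * a) expansion ⟩
      u ^ e * (1 + j * (N * g) + N * g * (N * g) * h) * a ≡⟨ regroup (u ^ e) a j N g h ⟩
      U + N * (j * z) + N * N * (g * g * h * U)          ≈⟨ CongMod-+N*N* _ _ p∣N ⟩
      U + N * (j * z)                                    ∎
      where
      open CongMod-Reasoning (N * p)
      regroup : ∀ w a j N g h → w * (1 + j * (N * g) + N * g * (N * g) * h) * a
                               ≡ w * a + N * (j * (g * (w * a))) + N * N * (g * g * h * (w * a))
      regroup = solve-∀

  invariant-step : ∀ {N p} .{{_ : NonZero p}} → p ∣ P → Invariant N → Invariant (N * p)
  invariant-step {N} {p} p∣P (P*P∣N , level , lifts) =
    ∣-trans P*P∣N (m∣m*n p) , level-step P*p∣N level , lifts-step p∣P p∣N level lifts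
    where
    P*p∣N : P * p ∣ N
    P*p∣N = ∣-trans (*-monoʳ-∣ P p∣P) P*P∣N
    p∣N : p ∣ N
    p∣N = ∣-trans p∣P (∣-trans (m∣m*n P) P*P∣N)

closed-prodFin : ∀ (G : ℕ → Set) ℓ (f : Fin ℓ → ℕ) → (∀ {n} i → G n → G (n * f i)) →
                 ∀ {n} → G n → G (n * prodFin ℓ f)
closed-prodFin G zero    f closed {n} Gn = subst G (sym (*-identityʳ n)) Gn
closed-prodFin G (suc ℓ) f closed {n} Gn =
  subst G (*-assoc n (f zero) _) (closed-prodFin G ℓ (λ i → f (suc i)) (λ i → closed (suc i)) (closed zero Gn))

closed-^ : ∀ (G : ℕ → Set) c → (∀ {n} → G n → G (n * c)) → ∀ k {n} → G n → G (n * c ^ k)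
closed-^ G c closed zero    {n} Gn = subst G (sym (*-identityʳ n)) Gn
closed-^ G c closed (suc k) {n} Gn = subst G (*-assoc n c (c ^ k)) (closed-^ G c closed k (closed Gn))

prodFin-^-∸ : ∀ ℓ (p α k : Fin ℓ → ℕ) → (∀ i → α i ≤ k i) →
  prodFin ℓ (λ i → p i ^ k i) ≡ prodFin ℓ (λ i → p i ^ α i) * prodFin ℓ (λ i → p i ^ (k i ∸ α i))
prodFin-^-∸ ℓ p α k α≤k = trans (prodFin-cong ℓ split) (prodFin-* ℓ _ _)
  where
  split : ∀ i → p i ^ k i ≡ p i ^ α i * p i ^ (k i ∸ α i)
  split i = trans (cong (p i ^_) (sym (m+[n∸m]≡n (α≤k i)))) (^-distribˡ-+-* (p i) (α i) (k i ∸ α i))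

raise-exponents : ∀ (G : ℕ → Set) ℓ (p : Fin ℓ → ℕ) → (∀ {n} i → G n → G (n * p i)) →
  ∀ b {α k : Fin ℓ → ℕ} → (∀ i → α i ≤ k i) →
  G (b * prodFin ℓ (λ i → p i ^ α i)) → G (b * prodFin ℓ (λ i → p i ^ k i))
raise-exponents G ℓ p closed b {α} {k} α≤k Gα = subst G (begin
  b * Πα * Πk∸α   ≡⟨ *-assoc b Πα Πk∸α ⟩
  b * (Πα * Πk∸α) ≡⟨ cong (b *_) (prodFin-^-∸ ℓ p α k α≤k) ⟨
  b * prodFin ℓ (λ i → p i ^ k i) ∎)
  (closed-prodFin G ℓ _ (λ i → closed-^ G (p i) (closed i) (k i ∸ α i)) Gα)
  where
  open ≡-Reasoning
  Πα Πk∸α : ℕ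
  Πα = prodFin ℓ (λ i → p i ^ α i)
  Πk∸α = prodFin ℓ (λ i → p i ^ (k i ∸ α i))

raise-exponents-∣ : ∀ ℓ (p : Fin ℓ → ℕ) b {α k : Fin ℓ → ℕ} → (∀ i → α i ≤ k i) →
  b * prodFin ℓ (λ i → p i ^ α i) ∣ b * prodFin ℓ (λ i → p i ^ k i)
raise-exponents-∣ ℓ p b {α} α≤k = raise-exponents (b * prodFin ℓ (λ i → p i ^ α i) ∣_) ℓ p (λ i d∣n → ∣-trans d∣n (m∣m*n (p i))) b α≤k ∣-refl

-- Cosets of ⟨q⟩_N and their representatives

InCoset-⊆ : ∀ {q N a b} n → CongMod N a (q ^ n * b) → ∀ x → InCoset q N a x → InCoset q N b x
InCoset-⊆ {q} {N} {a} {b} n a≡qⁿb x (x-unit , m , x≡qᵐa) = x-unit , m + n , (begin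
  x                   ≈⟨ x≡qᵐa ⟩
  q ^ m * a           ≈⟨ CongMod-*ˡ (q ^ m) a≡qⁿb ⟩
  q ^ m * (q ^ n * b) ≡⟨ *-assoc (q ^ m) (q ^ n) b ⟨
  q ^ m * q ^ n * b   ≡⟨ cong (_* b) (^-distribˡ-+-* q m n) ⟨
  q ^ (m + n) * b     ∎)
  where open CongMod-Reasoning N

cosets-equal : ∀ {q N a b} → (∃ λ m → CongMod N a (q ^ m * b)) → (∃ λ n → CongMod N b (q ^ n * a)) →
               SameSet (InCoset q N a) (InCoset q N b)
cosets-equal (m , a≡qᵐb) (n , b≡qⁿa) x = InCoset-⊆ m a≡qᵐb x , InCoset-⊆ n b≡qⁿa x

1+toℕ-InUnits : ∀ {M} (j : Fin M) → Coprime (suc (toℕ j)) M → InUnits M (suc (toℕ j))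
1+toℕ-InUnits j j+1⊥M = s≤s z≤n , toℕ<n j , coprime⇒gcd≡1 j+1⊥M

-- j : Fin M stands for suc (toℕ j) ∈ {1, …, M}; indices of non-units are sent to the unit 1.
unitRep : (M : ℕ) → Fin M → ℕ
unitRep M j with coprime? (suc (toℕ j)) M
... | yes _ = suc (toℕ j)
... | no  _ = 1

unitRep-InUnits : ∀ M .{{_ : NonZero M}} j → InUnits M (unitRep M j)
unitRep-InUnits M j with coprime? (suc (toℕ j)) M
... | yes j+1⊥M = 1+toℕ-InUnits j j+1⊥M
... | no  _     = s≤s z≤n , >-nonZero⁻¹ M , coprime⇒gcd≡1 (Coprimality.1-coprimeTo M)

unitRep-coprime : ∀ M j → Coprime (suc (toℕ j)) M → unitRep M j ≡ suc (toℕ j)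
unitRep-coprime M j j+1⊥M with coprime? (suc (toℕ j)) M
... | yes _      = refl
... | no  j+1⊥̸M = ⊥-elim (j+1⊥̸M j+1⊥M)

residueIndex : ∀ M .{{_ : NonZero M}} → ℕ → Fin M
residueIndex M x = fromℕ< (m%n<n (x ∸ 1) M)

CongMod-residueIndex : ∀ M .{{_ : NonZero M}} {x} → 1 ≤ x → CongMod M x (suc (toℕ (residueIndex M x)))
CongMod-residueIndex M {x} 1≤x = begin
  x                               ≡⟨ m+[n∸m]≡n 1≤x ⟨
  suc (x ∸ 1)                     ≈⟨ CongMod-+ˡ 1 (CongMod-% M (x ∸ 1)) ⟩
  suc ((x ∸ 1) % M)               ≡⟨ cong suc (toℕ-fromℕ< (m%n<n (x ∸ 1) M)) ⟨
  suc (toℕ (residueIndex M x))    ∎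
  where open CongMod-Reasoning M

coset-representatives : ∀ q {M N} .{{_ : NonZero M}} .{{_ : NonZero N}} → M ∣ N →
  (∀ x → Coprime x M → Coprime x N) →
  (∀ x a → CongMod M x a → Coprime a N → ∃ λ n → CongMod N x (q ^ n * a)) →
  ((x : ℕ) → InUnits N x → ∃ λ j → SameSet (InCoset q N x) (InCoset q N (unitRep M j))) ×
  ((j : Fin M) → ∃ λ x → InUnits N x × SameSet (InCoset q N (unitRep M j)) (InCoset q N x))
coset-representatives q {M} {N} M∣N M-unit⇒N-unit kernel⊆⟨q⟩ = listed , represented
  where
  listed : (x : ℕ) → InUnits N x → ∃ λ j → SameSet (InCoset q N x) (InCoset q N (unitRep M j))
  listed x (1≤x , _ , gcd[x,N]≡1) = j , subst (λ a → SameSet (InCoset q N x) (InCoset q N a)) (sym rep≡a)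
    (cosets-equal (kernel⊆⟨q⟩ x a x≡a a⊥N) (kernel⊆⟨q⟩ a x (CongMod-sym x≡a) x⊥N))
    where
    j : Fin M
    j = residueIndex M x
    a : ℕ
    a = suc (toℕ j)
    x≡a : CongMod M x a
    x≡a = CongMod-residueIndex M 1≤x
    x⊥N : Coprime x N
    x⊥N = gcd≡1⇒coprime gcd[x,N]≡1
    a⊥M : Coprime a M
    a⊥M = CongMod-coprime x≡a (coprime-∣ʳ x⊥N M∣N)
    a⊥N : Coprime a N
    a⊥N = M-unit⇒N-unit a a⊥M
    rep≡a : unitRep M j ≡ a
    rep≡a = unitRep-coprime M j a⊥M
  represented : (j : Fin M) → ∃ λ x → InUnits N x × SameSet (InCoset q N (unitRep M j)) (InCoset q N x)
  represented j = x , 1+toℕ-InUnits i x⊥N , cosets-equal (0 , q⁰* a≡x) (0 , q⁰* (CongMod-sym a≡x))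
    where
    a : ℕ
    a = unitRep M j
    a-unit : InUnits M a
    a-unit = unitRep-InUnits M j
    i : Fin N
    i = residueIndex N a
    x : ℕ
    x = suc (toℕ i)
    a≡x : CongMod N a x
    a≡x = CongMod-residueIndex N (proj₁ a-unit)
    x⊥N : Coprime x N
    x⊥N = CongMod-coprime a≡x (M-unit⇒N-unit a (gcd≡1⇒coprime (proj₂ (proj₂ a-unit))))
    q⁰* : ∀ {y z} → CongMod N y z → CongMod N y (q ^ 0 * z)
    q⁰* {y} {z} = subst (CongMod N y) (sym (*-identityˡ z))

-- The modulus A and the exponent k₀

module Construction (q b ℓ : ℕ) (p : Fin ℓ → ℕ) (p-prime : ∀ i → Prime (p i)) (2≤q : 2 ≤ q)
                    (q⊥bP : Coprime q (b * prodFin ℓ p)) .{{b≢0 : NonZero b}} where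

  P : ℕ
  P = prodFin ℓ p

  instance
    P≢0 : NonZero P
    P≢0 = prodFin-nonZero ℓ (λ i → prime⇒nonZero (p-prime i))
    q≢0 : NonZero q
    q≢0 = >-nonZero (≤-trans (s≤s z≤n) 2≤q)

  q⊥P : Coprime q P
  q⊥P = coprime-∣ʳ q⊥bP (n∣m*n b)

  K : ℕ
  K = b * P * P

  instance
    K≢0 : NonZero K
    K≢0 = m*n≢0 (b * P) P {{m*n≢0 b P}}

  order : ∃₂ λ D w → q ^ suc D ≡ 1 + K * w
  order = pow≡1+multiple {q} {K} (coprime-*ʳ q⊥bP q⊥P)

  d w u : ℕ
  d = suc (proj₁ order)
  w = proj₁ (proj₂ order)
  u = q ^ d

  u≡1+K*w : u ≡ 1 + K * w
  u≡1+K*w = proj₂ (proj₂ order)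

  1<u : 1 < u
  1<u = ≤-trans 2≤q (m≤m*n q (q ^ proj₁ order) {{m^n≢0 q (proj₁ order)}})

  factorisation : ∃₂ λ (β : Fin ℓ → ℕ) g → w ≡ prodFin ℓ (λ i → p i ^ β i) * g × Coprime g P
  factorisation = split-prime-powers ℓ p p-prime w {{1<1+K*w⇒w≢0 {K} {w} (subst (1 <_) u≡1+K*w 1<u)}}

  β : Fin ℓ → ℕ
  β = proj₁ factorisation
  g Πβ : ℕ
  g = proj₁ (proj₂ factorisation)
  Πβ = prodFin ℓ (λ i → p i ^ β i)

  w≡Πβ*g : w ≡ Πβ * g
  w≡Πβ*g = proj₁ (proj₂ (proj₂ factorisation))

  α : Fin ℓ → ℕ
  α i = 2 + β i

  A : ℕ
  A = b * prodFin ℓ (λ i → p i ^ α i)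

  A≡K*Πβ : A ≡ K * Πβ
  A≡K*Πβ = begin
    b * prodFin ℓ (λ i → p i * (p i * p i ^ β i)) ≡⟨ cong (b *_) (prodFin-* ℓ p _) ⟩
    b * (P * prodFin ℓ (λ i → p i * p i ^ β i))   ≡⟨ cong (λ v → b * (P * v)) (prodFin-* ℓ p _) ⟩
    b * (P * (P * Πβ))                            ≡⟨ reassoc b P Πβ ⟩
    b * P * P * Πβ                                ∎
    where
    open ≡-Reasoning
    reassoc : ∀ b P Π → b * (P * (P * Π)) ≡ b * P * P * Π
    reassoc = solve-∀

  P*P∣A : P * P ∣ A
  P*P∣A = divides (b * Πβ) (trans A≡K*Πβ (reorder b P Πβ))
    where
    reorder : ∀ b P Π → b * P * P * Π ≡ b * Π * (P * P)
    reorder = solve-∀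

  b*P∣A : b * P ∣ A
  b*P∣A = divides (P * Πβ) (trans A≡K*Πβ (reorder b P Πβ))
    where
    reorder : ∀ b P Π → b * P * P * Π ≡ P * Π * (b * P)
    reorder = solve-∀

  open Lifting u P A (coprime-^ˡ q⊥P d)

  invariant-A : Invariant A
  invariant-A = P*P∣A , (1 , g , u¹≡1+A*g , proj₂ (proj₂ (proj₂ factorisation))) , lifts-A
    where
    open ≡-Reasoning
    u¹≡1+A*g : u ^ 1 ≡ 1 + A * g
    u¹≡1+A*g = begin
      u ^ 1           ≡⟨ *-identityʳ u ⟩
      u               ≡⟨ u≡1+K*w ⟩
      1 + K * w       ≡⟨ cong (λ v → 1 + K * v) w≡Πβ*g ⟩
      1 + K * (Πβ * g) ≡⟨ cong (1 +_) (*-assoc K Πβ g) ⟨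
      1 + K * Πβ * g  ≡⟨ cong (λ v → 1 + v * g) A≡K*Πβ ⟨
      1 + A * g       ∎
    lifts-A : Lifts A
    lifts-A x a x≡a _ = 0 , subst (CongMod A x) (sym (*-identityˡ a)) x≡a

  k₀ : ℕ
  k₀ = maxFin ℓ α

  M : ℕ
  M = b * P ^ k₀

  N : (Fin ℓ → ℕ) → ℕ
  N k = b * prodFin ℓ (λ i → p i ^ k i)

  instance
    M≢0 : NonZero M
    M≢0 = m*n≢0 b (P ^ k₀) {{b≢0}} {{m^n≢0 P k₀}}

  N≢0 : ∀ k → NonZero (N k)
  N≢0 k = m*n≢0 b _ {{b≢0}} {{prodFin-nonZero ℓ (λ i → m^n≢0 (p i) (k i) {{prime⇒nonZero (p-prime i)}})}}

  M≡N[k₀] : M ≡ N (λ _ → k₀)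
  M≡N[k₀] = cong (b *_) (prodFin-^ ℓ p k₀)

  A∣M : A ∣ M
  A∣M = subst (A ∣_) (sym M≡N[k₀]) (raise-exponents-∣ ℓ p b (≤maxFin ℓ α))

  module _ (k : Fin ℓ → ℕ) (k₀≤k : ∀ i → k₀ ≤ k i) where

    M∣N : M ∣ N k
    M∣N = subst (_∣ N k) (sym M≡N[k₀]) (raise-exponents-∣ ℓ p b k₀≤k)

    invariant-N : Invariant (N k)
    invariant-N = raise-exponents Invariant ℓ p (λ i → invariant-step {{prime⇒nonZero (p-prime i)}} (∣prodFin ℓ p i))
                    b (λ i → ≤-trans (≤maxFin ℓ α i) (k₀≤k i)) invariant-A

    M-unit⇒N-unit : ∀ x → Coprime x M → Coprime x (N k)
    M-unit⇒N-unit x x⊥M = coprime-*ʳ {n = b} (coprime-∣ʳ x⊥bP (m∣m*n P))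
      (coprime-prodFinʳ ℓ (λ i → coprime-^ʳ (coprime-∣ʳ x⊥bP (∣-trans (∣prodFin ℓ p i) (n∣m*n b))) (k i)))
      where
      x⊥bP : Coprime x (b * P)
      x⊥bP = coprime-∣ʳ x⊥M (∣-trans b*P∣A A∣M)

    kernel⊆⟨q⟩ : ∀ x a → CongMod M x a → Coprime a (N k) → ∃ λ n → CongMod (N k) x (q ^ n * a)
    kernel⊆⟨q⟩ x a x≡a a⊥N =
      map (d *_) (λ {e} → subst (λ v → CongMod (N k) x (v * a)) (^-*-assoc q d e))
        (proj₂ (proj₂ invariant-N) x a (CongMod-∣ A∣M x≡a) (coprime-∣ʳ a⊥N (∣-trans (m∣m*n P) (proj₁ invariant-N))))

lemma3p5 : (q b ℓ : ℕ) → (p : Fin ℓ → ℕ) → 3 ≤ q → (∀ i → Prime (p i)) → Injective _≡_ _≡_ p → gcd q (b * prodFin ℓ p) ≡ 1 →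
    Σ ℕ λ k₀ → Σ ℕ λ m → Σ (Fin m → ℕ) λ a →
      (∀ j → InUnits (b * prodFin ℓ p ^ k₀) (a j)) ×
      ((k : Fin ℓ → ℕ) → (∀ i → k₀ ≤ k i) → 
        ((x : ℕ) → InUnits (b * prodFin ℓ (λ i → p i ^ k i)) x → ∃ λ j →
          SameSet (InCoset q (b * prodFin ℓ (λ i → p i ^ k i)) x) (InCoset q (b * prodFin ℓ (λ i → p i ^ k i)) (a j))) ×
        ((j : Fin m) → ∃ λ x → InUnits (b * prodFin ℓ (λ i → p i ^ k i)) x ×
          SameSet (InCoset q (b * prodFin ℓ (λ i → p i ^ k i)) (a j)) (InCoset q (b * prodFin ℓ (λ i → p i ^ k i)) x)))
lemma3p5 q zero ℓ p 3≤q _ _ gcd[q,0]≡1 = contradiction (subst (3 ≤_) (trans (sym (gcd-identityʳ q)) gcd[q,0]≡1) 3≤q) λ { (s≤s ()) }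
lemma3p5 q b@(suc _) ℓ p 3≤q p-prime _ gcd[q,bP]≡1 = k₀ , M , unitRep M , unitRep-InUnits M , λ k k₀≤k →
  coset-representatives q {{M≢0}} {{N≢0 k}} (M∣N k k₀≤k) (M-unit⇒N-unit k k₀≤k) (kernel⊆⟨q⟩ k k₀≤k)
  where open Construction q b ℓ p p-prime (≤-trans (n≤1+n 2) 3≤q) (gcd≡1⇒coprime gcd[q,bP]≡1)
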